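{- Let $n\ge 2$, $i\in\{0,\ldots,n-1\}$, and let $h$ be a Hamiltonian cycle of $Q_n$. Among the edges of $h$ that are $i$-th dimension edges, exactly half have $i$-parity $0$ and exactly half have $i$-parity $1$. Equivalently, half of the $i$-th dimension edges of $h$ lie in the $0$-bipartition class of $\mathcal{D}_{in}$ and half lie in the $1$-bipartition class.
   Context: $Q_n$ is the hypercube on $\{0,1\}^n$ (coordinates indexed $0,\ldots,n-1$), vertices adjacent iff they differ in exactly one coordinate. An $i$-th dimension edge is an edge $\{u,u+e_i\}$ ($e_i$ the $i$-th basis vector, addition mod 2). For $v\in\{0,1\}^n$, $\mathrm{par}_{in}(v)$ is the number of $1$'s among the coordinates of $v$ other than the $i$-th, taken mod 2; the $i$-parity of the edge $\{u,u+e_i\}$ is $\mathrm{par}_{in}(u)=\mathrm{par}_{in}(u+e_i)$. The graph $\mathcal{D}_{in}$ has the $i$-th dimension edges as vertices, two being adjacent iff they are opposite edges of a 4-cycle of $Q_n$; it is bipartite with $b$-bipartition class consisting of the $i$-th dimension edges of $i$-parity $b$, $b\in\{0,1\}$. -}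

module Defs where

open import Data.Nat using (ℕ; zero; suc; _+_; _^_; _<?_)
open import Data.Bool using (Bool; true; false; _xor_; _∧_; if_then_else_)
open import Data.Fin using (Fin; zero; suc; toℕ; fromℕ<)
open import Data.Vec using (Vec; []; _∷_; lookup)
open import Relation.Nullary using (yes; no)
open import Relation.Binary.PropositionalEquality using (_≡_)
open import Function.Definitions using (Injective)

-- Vertices of Q_n : {0,1}^n, with 0 = false, 1 = true, coordinates Fin n.
Vertex : ℕ → Set
Vertex n = Vec Bool n

hamming : ∀ {n} → Vertex n → Vertex n → ℕ
hamming []       []       = 0
hamming (x ∷ xs) (y ∷ ys) = (if x xor y then 1 else 0) + hamming xs ys

Adjacent : ∀ {n} → Vertex n → Vertex n → Set
Adjacent u v = hamming u v ≡ 1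

parity : ∀ {n} → Vertex n → Bool
parity []       = false
parity (x ∷ xs) = x xor parity xs

-- par_{in}(v): number of 1's among coordinates other than the i-th, mod 2
parExcept : ∀ {n} → Fin n → Vertex n → Bool
parExcept zero    (x ∷ xs) = parity xs
parExcept (suc i) (x ∷ xs) = x xor parExcept i xs

next : ∀ {N} → Fin N → Fin N
next {suc m} k with suc (toℕ k) <? suc m
... | yes p = fromℕ< p
... | no _  = zero

-- A Hamiltonian cycle of Q_n: a cyclic ordering (v_0,...,v_{2^n-1}) of all
-- 2^n vertices (injective, hence bijective), with consecutive vertices
-- (including v_{2^n-1}, v_0) adjacent. Its edges are {v_k, v_{k+1 mod 2^n}}.
record HamiltonianCycle (n : ℕ) : Set where
  field
    vertexAt  : Fin (2 ^ n) → Vertex n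
    injective : Injective _≡_ _≡_ vertexAt
    adjacent  : ∀ k → Adjacent (vertexAt k) (vertexAt (next k))

countFin : ∀ {N} → (Fin N → Bool) → ℕ
countFin {zero}  p = 0
countFin {suc N} p = (if p zero then 1 else 0) + countFin {N} (λ k → p (suc k))

_==_ : Bool → Bool → Bool
false == false = true
true  == true  = true
_     == _     = false

module _ {n : ℕ} (h : HamiltonianCycle n) where
  open HamiltonianCycle h

  isDimEdge : Fin n → Fin (2 ^ n) → Bool
  isDimEdge i k = lookup (vertexAt k) i xor lookup (vertexAt (next k)) i

  -- i-parity of the k-th edge: par_{in} of its endpoint v_k
  edgeParity : Fin n → Fin (2 ^ n) → Bool
  edgeParity i k = parExcept i (vertexAt k)

  countDimParity : Fin n → Bool → ℕ
  countDimParity i b = countFin (λ k → isDimEdge i k ∧ (edgeParity i k == b))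

-- Along a Hamiltonian cycle the i-parity of the current vertex is kept by
-- i-th dimension edges and flipped by all other edges. For n ≥ 2 both
-- i-parity classes contain 2^(n-1) vertices, and the cycle visits each vertex
-- once, so each value b is taken 2^(n-1) times both by the start and by the
-- end vertices of the edges. Splitting these two counts into crossing
-- (i-th dimension) and staying edges gives c_b + s_b = 2^(n-1) and
-- c_b + s_(¬b) = 2^(n-1), whence s_0 = s_1 and then c_0 = c_1.
module Submission where

open import Defs
open import Data.Bool using (Bool; true; false; not; _xor_; _∧_; if_then_else_)
open import Data.Bool.Properties as Bool using (∧-identityʳ; not-involutive; xor-assoc)
open import Data.Fin using (Fin; zero; suc; toℕ; fromℕ<)
open import Data.Fin.Properties as Fin using (toℕ-injective; toℕ-fromℕ<; toℕ<n)
open import Data.Nat using (ℕ; zero; suc; _+_; _^_; _≤_; _<_; _<?_; z≤n; s≤s)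
open import Data.Nat.Properties
open import Algebra.Properties.CommutativeSemigroup +-commutativeSemigroup using (interchange; x∙yz≈y∙xz)
open import Data.Vec using ([]; _∷_; lookup)
open import Data.Vec.Properties using (≡-dec)
open import Function.Definitions using (Injective)
open import Relation.Binary.Definitions using (DecidableEquality)
open import Relation.Nullary using (¬_; yes; no; does; contradiction)
open import Relation.Binary.PropositionalEquality

bit : Bool → ℕ
bit b = if b then 1 else 0

bit-complement : ∀ b → bit b + bit (not b) ≡ 1
bit-complement false = refl
bit-complement true  = refl

bit-partition : ∀ r q → bit q ≡ bit (r ∧ q) + bit (not r ∧ q)
bit-partition false q     = refl
bit-partition true  false = refl
bit-partition true  true  = refl

not-== : ∀ x y → (not x == y) ≡ not (x == y)
not-== false false = refl
not-== false true  = refl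
not-== true  false = refl
not-== true  true  = refl

==-not : ∀ x y → (x == not y) ≡ not (x == y)
==-not false false = refl
==-not false true  = refl
==-not true  false = refl
==-not true  true  = refl

countFin-cong : ∀ {N} {P Q : Fin N → Bool} → (∀ k → P k ≡ Q k) → countFin P ≡ countFin Q
countFin-cong {zero}  eq = refl
countFin-cong {suc N} eq = cong₂ _+_ (cong bit (eq zero)) (countFin-cong (λ k → eq (suc k)))

countFin-complement : ∀ {N} (Q : Fin N → Bool) → countFin Q + countFin (λ k → not (Q k)) ≡ N
countFin-complement {zero}  Q = refl
countFin-complement {suc N} Q =
  trans (interchange (bit (Q zero)) _ (bit (not (Q zero))) _)
        (cong₂ _+_ (bit-complement (Q zero)) (countFin-complement (λ k → Q (suc k))))

countFin-partition : ∀ {N} (R Q : Fin N → Bool) →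
  countFin Q ≡ countFin (λ k → R k ∧ Q k) + countFin (λ k → not (R k) ∧ Q k)
countFin-partition {zero}  R Q = refl
countFin-partition {suc N} R Q =
  trans (cong₂ _+_ (bit-partition (R zero) (Q zero)) (countFin-partition (λ k → R (suc k)) (λ k → Q (suc k))))
        (interchange (bit (R zero ∧ Q zero)) (bit (not (R zero) ∧ Q zero)) _ _)

countVertices : ∀ {n} → (Vertex n → Bool) → ℕ
countVertices {zero}  Q = bit (Q [])
countVertices {suc n} Q = countVertices (λ v → Q (false ∷ v)) + countVertices (λ v → Q (true ∷ v))

countVertices-cong : ∀ {n} {P Q : Vertex n → Bool} → (∀ v → P v ≡ Q v) →
  countVertices P ≡ countVertices Q
countVertices-cong {zero}  eq = cong bit (eq [])
countVertices-cong {suc n} eq =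
  cong₂ _+_ (countVertices-cong (λ v → eq (false ∷ v))) (countVertices-cong (λ v → eq (true ∷ v)))

countVertices-complement : ∀ {n} (Q : Vertex n → Bool) →
  countVertices Q + countVertices (λ v → not (Q v)) ≡ 2 ^ n
countVertices-complement {zero}  Q = bit-complement (Q [])
countVertices-complement {suc n} Q =
  trans (interchange (countVertices (λ v → Q (false ∷ v))) _ _ _)
        (trans (cong₂ _+_ (countVertices-complement (λ v → Q (false ∷ v)))
                          (countVertices-complement (λ v → Q (true ∷ v))))
               (cong (2 ^ n +_) (sym (+-identityʳ (2 ^ n)))))

_≟ᵛ_ : ∀ {n} → DecidableEquality (Vertex n)
_≟ᵛ_ = ≡-dec Bool._≟_

countVertices-remove : ∀ {n} (Q : Vertex n → Bool) (w : Vertex n) →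
  countVertices Q ≡ bit (Q w) + countVertices (λ v → Q v ∧ not (does (v ≟ᵛ w)))
countVertices-remove {zero} Q [] with Q []
... | false = refl
... | true  = refl
countVertices-remove {suc n} Q (false ∷ w) =
  trans (cong₂ _+_ (countVertices-remove (λ v → Q (false ∷ v)) w)
                   (countVertices-cong (λ v → sym (∧-identityʳ (Q (true ∷ v))))))
        (+-assoc (bit (Q (false ∷ w))) _ _)
countVertices-remove {suc n} Q (true ∷ w) =
  trans (cong₂ _+_ (countVertices-cong (λ v → sym (∧-identityʳ (Q (false ∷ v)))))
                   (countVertices-remove (λ v → Q (true ∷ v)) w))
        (x∙yz≈y∙xz (countVertices (λ v → Q (false ∷ v) ∧ true)) (bit (Q (true ∷ w))) _)

countFin-∘-injective-≤ : ∀ {N n} {f : Fin N → Vertex n} → Injective _≡_ _≡_ f →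
  (Q : Vertex n → Bool) → countFin (λ k → Q (f k)) ≤ countVertices Q
countFin-∘-injective-≤ {zero}          f-inj Q = z≤n
countFin-∘-injective-≤ {suc N} {f = f} f-inj Q = begin
  bit (Q (f zero)) + countFin (λ k → Q (f (suc k)))   ≡⟨ cong (bit (Q (f zero)) +_) (countFin-cong keep-rest) ⟩
  bit (Q (f zero)) + countFin (λ k → Q′ (f (suc k)))  ≤⟨ +-monoʳ-≤ (bit (Q (f zero))) rest-≤ ⟩
  bit (Q (f zero)) + countVertices Q′                 ≡⟨ countVertices-remove Q (f zero) ⟨
  countVertices Q                                     ∎
  where
  open ≤-Reasoning
  Q′ : Vertex _ → Bool
  Q′ v = Q v ∧ not (does (v ≟ᵛ f zero))
  rest-≤ : countFin (λ k → Q′ (f (suc k))) ≤ countVertices Q′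
  rest-≤ = countFin-∘-injective-≤ (λ eq → Fin.suc-injective (f-inj eq)) Q′
  keep-rest : ∀ k → Q (f (suc k)) ≡ Q′ (f (suc k))
  keep-rest k with f (suc k) ≟ᵛ f zero
  ... | yes eq = contradiction (f-inj eq) (λ ())
  ... | no  _  = sym (∧-identityʳ _)

m≤o⇒n≤o⇒m+n≡o+o⇒m≡o : ∀ {m n o} → m ≤ o → n ≤ o → m + n ≡ o + o → m ≡ o
m≤o⇒n≤o⇒m+n≡o+o⇒m≡o {m} {n} {o} m≤o n≤o m+n≡o+o =
  ≤-antisym m≤o (+-cancelʳ-≤ o o m (≤-trans (≤-reflexive (sym m+n≡o+o)) (+-monoʳ-≤ m n≤o)))

next-injective : ∀ {N} → Injective _≡_ _≡_ (next {N})
next-injective {suc m} {k} {l} eq with suc (toℕ k) <? suc m | suc (toℕ l) <? suc m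
... | yes p | yes q = toℕ-injective (suc-injective (begin
  suc (toℕ k)      ≡⟨ toℕ-fromℕ< p ⟨
  toℕ (fromℕ< p)   ≡⟨ cong toℕ eq ⟩
  toℕ (fromℕ< q)   ≡⟨ toℕ-fromℕ< q ⟩
  suc (toℕ l)      ∎))
  where open ≡-Reasoning
... | yes p | no  _ = contradiction (trans (sym (cong toℕ eq)) (toℕ-fromℕ< p)) 0≢1+n
... | no  _ | yes q = contradiction (trans (cong toℕ eq) (toℕ-fromℕ< q)) 0≢1+n
... | no  p | no  q = toℕ-injective (suc-injective (trans (last p) (sym (last q))))
  where
  last : ∀ {j} → ¬ suc (toℕ j) < suc m → suc (toℕ j) ≡ suc m
  last {j} j≮ = ≤-antisym (toℕ<n j) (≮⇒≥ j≮)

hamming≡0⇒≡ : ∀ {n} (u w : Vertex n) → hamming u w ≡ 0 → u ≡ w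
hamming≡0⇒≡ []           []           _  = refl
hamming≡0⇒≡ (false ∷ us) (false ∷ ws) eq = cong (false ∷_) (hamming≡0⇒≡ us ws eq)
hamming≡0⇒≡ (true  ∷ us) (true  ∷ ws) eq = cong (true ∷_) (hamming≡0⇒≡ us ws eq)

adjacent⇒parity-flips : ∀ {n} (u w : Vertex n) → Adjacent u w → parity w ≡ not (parity u)
adjacent⇒parity-flips []           []           ()
adjacent⇒parity-flips (false ∷ us) (false ∷ ws) adj = adjacent⇒parity-flips us ws adj
adjacent⇒parity-flips (true  ∷ us) (true  ∷ ws) adj = cong not (adjacent⇒parity-flips us ws adj)
adjacent⇒parity-flips (false ∷ us) (true  ∷ ws) adj
  rewrite hamming≡0⇒≡ us ws (suc-injective adj) = refl
adjacent⇒parity-flips (true  ∷ us) (false ∷ ws) adj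
  rewrite hamming≡0⇒≡ us ws (suc-injective adj) = sym (not-involutive (parity ws))

parExcept≡parity-xor-lookup : ∀ {n} (i : Fin n) (v : Vertex n) → parExcept i v ≡ parity v xor lookup v i
parExcept≡parity-xor-lookup zero    (x ∷ xs) = sym (xor-cancelʳ x (parity xs))
  where
  xor-cancelʳ : ∀ x y → (x xor y) xor x ≡ y
  xor-cancelʳ false false = refl
  xor-cancelʳ false true  = refl
  xor-cancelʳ true  false = refl
  xor-cancelʳ true  true  = refl
parExcept≡parity-xor-lookup (suc i) (x ∷ xs) =
  trans (cong (x xor_) (parExcept≡parity-xor-lookup i xs)) (sym (xor-assoc x (parity xs) (lookup xs i)))

adjacent⇒parExcept : ∀ {n} (i : Fin n) (u w : Vertex n) → Adjacent u w →
  parExcept i w ≡ (if lookup u i xor lookup w i then parExcept i u else not (parExcept i u))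
adjacent⇒parExcept i u w adj = begin
  parExcept i w                        ≡⟨ parExcept≡parity-xor-lookup i w ⟩
  parity w xor lookup w i              ≡⟨ cong (_xor lookup w i) (adjacent⇒parity-flips u w adj) ⟩
  not (parity u) xor lookup w i        ≡⟨ not-xor≡if (parity u) (lookup u i) (lookup w i) ⟩
  (if lookup u i xor lookup w i then parity u xor lookup u i else not (parity u xor lookup u i))
    ≡⟨ cong (λ p → if lookup u i xor lookup w i then p else not p) (parExcept≡parity-xor-lookup i u) ⟨
  (if lookup u i xor lookup w i then parExcept i u else not (parExcept i u)) ∎
  where
  open ≡-Reasoning
  not-xor≡if : ∀ p x y → not p xor y ≡ (if x xor y then p xor x else not (p xor x))
  not-xor≡if false false false = refl
  not-xor≡if false false true  = refl
  not-xor≡if false true  false = refl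
  not-xor≡if false true  true  = refl
  not-xor≡if true  false false = refl
  not-xor≡if true  false true  = refl
  not-xor≡if true  true  false = refl
  not-xor≡if true  true  true  = refl

countVertices-==+countVertices-not-== : ∀ {m} (f : Vertex m → Bool) (b : Bool) →
  countVertices (λ v → f v == b) + countVertices (λ v → not (f v) == b) ≡ 2 ^ m
countVertices-==+countVertices-not-== f b =
  trans (cong (countVertices (λ v → f v == b) +_) (countVertices-cong (λ v → not-== (f v) b)))
        (countVertices-complement (λ v → f v == b))

-- Needs m ≥ 1 for i = zero: parExcept zero ignores the head, and the parity of
-- the empty tail is constant.
countVertices-parExcept : ∀ {m} → 1 ≤ m → (i : Fin (suc m)) (b : Bool) →
  countVertices (λ v → parExcept i v == b) ≡ 2 ^ m
countVertices-parExcept {suc m} _ zero b =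
  trans (cong₂ _+_ (countVertices-==+countVertices-not-== {m} parity b)
                   (countVertices-==+countVertices-not-== {m} parity b))
        (cong (2 ^ m +_) (sym (+-identityʳ (2 ^ m))))
countVertices-parExcept _ (suc i) b = countVertices-==+countVertices-not-== (parExcept i) b

countFin-parExcept-∘-injective : ∀ {m} → 1 ≤ m → (i : Fin (suc m)) {f : Fin (2 ^ suc m) → Vertex (suc m)} →
  Injective _≡_ _≡_ f → (b : Bool) → countFin (λ k → parExcept i (f k) == b) ≡ 2 ^ m
countFin-parExcept-∘-injective {m} 1≤m i {f} f-inj b =
  m≤o⇒n≤o⇒m+n≡o+o⇒m≡o (bound b) (bound (not b)) total
  where
  bound : ∀ b′ → countFin (λ k → parExcept i (f k) == b′) ≤ 2 ^ m
  bound b′ = subst (countFin (λ k → parExcept i (f k) == b′) ≤_) (countVertices-parExcept 1≤m i b′)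
                   (countFin-∘-injective-≤ f-inj (λ v → parExcept i v == b′))
  total : countFin (λ k → parExcept i (f k) == b) + countFin (λ k → parExcept i (f k) == not b) ≡ 2 ^ m + 2 ^ m
  total = trans (cong (countFin (λ k → parExcept i (f k) == b) +_) (countFin-cong (λ k → ==-not (parExcept i (f k)) b)))
                (trans (countFin-complement (λ k → parExcept i (f k) == b)) (cong (2 ^ m +_) (+-identityʳ (2 ^ m))))

crossings-balanced : ∀ {N K} (d p q : Fin N → Bool) →
  (∀ k → q k ≡ (if d k then p k else not (p k))) →
  (∀ b → countFin (λ k → p k == b) ≡ K) →
  (∀ b → countFin (λ k → q k == b) ≡ K) →
  countFin (λ k → d k ∧ (p k == false)) ≡ countFin (λ k → d k ∧ (p k == true))
crossings-balanced {K = K} d p q step p-count q-count =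
  +-cancelʳ-≡ (staying true) (crossing false) (crossing true) (begin
    crossing false + staying true   ≡⟨ cong (crossing false +_) staying-balanced ⟨
    crossing false + staying false  ≡⟨ split-p false ⟩
    K                               ≡⟨ split-p true ⟨
    crossing true + staying true    ∎)
  where
  open ≡-Reasoning
  crossing staying : Bool → ℕ
  crossing b = countFin (λ k → d k ∧ (p k == b))
  staying  b = countFin (λ k → not (d k) ∧ (p k == b))

  split-p : ∀ b → crossing b + staying b ≡ K
  split-p b = trans (sym (countFin-partition d (λ k → p k == b))) (p-count b)

  split-q : ∀ b → crossing b + staying (not b) ≡ K
  split-q b = trans (cong₂ _+_ (countFin-cong crossing-step) (countFin-cong staying-step))
                    (trans (sym (countFin-partition d (λ k → q k == b))) (q-count b))
    where
    crossing-step : ∀ k → (d k ∧ (p k == b)) ≡ (d k ∧ (q k == b))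
    crossing-step k rewrite step k with d k
    ... | true  = refl
    ... | false = refl
    staying-step : ∀ k → (not (d k) ∧ (p k == not b)) ≡ (not (d k) ∧ (q k == b))
    staying-step k rewrite step k with d k
    ... | true  = refl
    ... | false = trans (==-not (p k) b) (sym (not-== (p k) b))

  staying-balanced : staying false ≡ staying true
  staying-balanced = +-cancelˡ-≡ (crossing false) (staying false) (staying true)
                                 (trans (split-p false) (sym (split-q false)))

theorem2 : (n : ℕ) → 2 ≤ n → (i : Fin n) → (h : HamiltonianCycle n)
    → countDimParity h i false ≡ countDimParity h i true
theorem2 (suc m) (s≤s 1≤m) i h =
  crossings-balanced (isDimEdge h i) (edgeParity h i) (λ k → edgeParity h i (next k))
    (λ k → adjacent⇒parExcept i (vertexAt k) (vertexAt (next k)) (adjacent k))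
    (countFin-parExcept-∘-injective 1≤m i injective)
    (countFin-parExcept-∘-injective 1≤m i (λ eq → next-injective (injective eq)))
  where open HamiltonianCycle h
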